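{- Let $I$ be a linear order (with at least two elements) and let $(P_i=(V_i,\le_i))_{i\in I}$ be a family of pairwise disjoint prime posets with $|V_i|\ge 4$ for all $i\in I$. If $M$ is a nontrivial module of the linear sum $\sum_{i\in I}P_i$, then there exists a nontrivial interval $J$ of $I$ such that $M=\bigcup_{j\in J}V_j$.
   Context: The linear sum $\sum_{i\in I}P_i$ is the poset on $\bigcup_i V_i$ with $x\le y$ iff either $x,y\in V_i$ and $x\le_i y$, or $x\in V_i,y\in V_j$ with $i<j$ in $I$. A module of a poset $(V,\le)$ is a subset $A$ such that for all $a,a'\in A$ and $x\notin A$: $x\le a\iff x\le a'$ and $a\le x\iff a'\le x$; the trivial modules are $\varnothing$, singletons and $V$, and a poset is prime if all its modules are trivial. A nontrivial interval of $I$ here means a nonempty interval different from $I$. -}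

module Defs where

open import Data.Product using (Σ; ∃; _×_; _,_)
open import Data.Sum using (_⊎_)
open import Relation.Nullary using (¬_)
open import Relation.Binary.PropositionalEquality using (_≡_; _≢_)
open import Function.Bundles using (_⇔_)

Subset : Set → Set₁
Subset X = X → Set

IsModule : {X : Set} → (X → X → Set) → Subset X → Set
IsModule {X} _≤_ A =
  ∀ (a a' x : X) → A a → A a' → ¬ A x →
    ((x ≤ a) ⇔ (x ≤ a')) × ((a ≤ x) ⇔ (a' ≤ x))

IsTrivial : {X : Set} → Subset X → Set
IsTrivial {X} A =
  (∀ x → ¬ A x) ⊎ (∃ λ (x : X) → ∀ y → A y ⇔ (y ≡ x)) ⊎ (∀ x → A x)

IsNontrivialModule : {X : Set} → (X → X → Set) → Subset X → Set
IsNontrivialModule _≤_ A = IsModule _≤_ A × ¬ IsTrivial A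

IsPrime : {X : Set} → (X → X → Set) → Set₁
IsPrime {X} _≤_ = ∀ (A : Subset X) → IsModule _≤_ A → IsTrivial A

AtLeast4 : Set → Set
AtLeast4 X = Σ X λ a → Σ X λ b → Σ X λ c → Σ X λ d →
  a ≢ b × a ≢ c × a ≢ d × b ≢ c × b ≢ d × c ≢ d

-- Linear sum of the family (V i, ≤ i) indexed by (I, <).
-- The vertex sets are made pairwise disjoint by taking Σ I V.
data LinSum≤ {I : Set} (_<_ : I → I → Set) (V : I → Set)
             (_≤[_]_ : ∀ {i} → V i → I → V i → Set) :
             Σ I V → Σ I V → Set where
  inside : ∀ {i} {x y : V i} → x ≤[ i ] y → LinSum≤ _<_ V _≤[_]_ (i , x) (i , y)
  across : ∀ {i j} {x : V i} {y : V j} → i < j → LinSum≤ _<_ V _≤[_]_ (i , x) (j , y)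

IsInterval : {I : Set} → (I → I → Set) → Subset I → Set
IsInterval {I} _<_ J = ∀ (a b c : I) → a < b → b < c → J a → J c → J b

IsNontrivialInterval : {I : Set} → (I → I → Set) → Subset I → Set
IsNontrivialInterval {I} _<_ J = IsInterval _<_ J × (∃ λ (i : I) → J i) × ¬ (∀ i → J i)

{-# OPTIONS --safe #-}
-- A module M of the linear sum meets each summand V i in a module of V i, hence (V i being prime)
-- in ∅, a single point or all of V i. A single point a is impossible: either M = {(i , a)}, or M
-- also meets some V j with j ≠ i, and then the module property forces a to be the maximum
-- (j above i) or the minimum (j below i) of V i; but the complement of an extremum of a poset is
-- a module, which is nontrivial once there are at least three points. So M is a union of whole
-- summands, and their indices form an interval because V j lies between V i and V k whenever
-- i < j < k.
module Submission where

open import Defs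
open import Data.Product using (Σ; ∃; _×_; _,_; proj₁; proj₂)
open import Data.Sum using (_⊎_; inj₁; inj₂)
open import Data.Empty using (⊥; ⊥-elim)
open import Relation.Nullary using (¬_; yes; no)
open import Relation.Binary.PropositionalEquality using (_≡_; _≢_; refl; sym; trans; cong)
open import Relation.Binary.Structures using (IsStrictTotalOrder; IsPartialOrder)
open import Relation.Binary.Definitions using (Tri; tri<; tri≈; tri>)
open import Function.Bundles using (_⇔_; mk⇔; Equivalence)
open import Axiom.ExcludedMiddle using (ExcludedMiddle)
open import Axiom.DoubleNegationElimination using (em⇒dne)
open import Level using (0ℓ)

open Equivalence using (to; from)

AtLeast3 : Set → Set
AtLeast3 X = Σ X λ a → Σ X λ b → Σ X λ c → a ≢ b × a ≢ c × b ≢ c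

atLeast4⇒atLeast3 : ∀ {X} → AtLeast4 X → AtLeast3 X
atLeast4⇒atLeast3 (a , b , c , _ , a≢b , a≢c , _ , b≢c , _) = a , b , c , a≢b , a≢c , b≢c

coveredByTwo⇒¬atLeast3 : ∀ {X} {a c : X} → (∀ y → y ≡ a ⊎ y ≡ c) → ¬ AtLeast3 X
coveredByTwo⇒¬atLeast3 {a = a} {c} cover (x , y , z , x≢y , x≢z , y≢z) =
  pigeonhole (cover x) (cover y) (cover z)
  where
  pigeonhole : x ≡ a ⊎ x ≡ c → y ≡ a ⊎ y ≡ c → z ≡ a ⊎ z ≡ c → ⊥
  pigeonhole (inj₁ x≡a) (inj₁ y≡a) _ = x≢y (trans x≡a (sym y≡a))
  pigeonhole (inj₂ x≡c) (inj₂ y≡c) _ = x≢y (trans x≡c (sym y≡c))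
  pigeonhole (inj₁ x≡a) _ (inj₁ z≡a) = x≢z (trans x≡a (sym z≡a))
  pigeonhole (inj₂ x≡c) _ (inj₂ z≡c) = x≢z (trans x≡c (sym z≡c))
  pigeonhole _ (inj₁ y≡a) (inj₁ z≡a) = y≢z (trans y≡a (sym z≡a))
  pigeonhole _ (inj₂ y≡c) (inj₂ z≡c) = y≢z (trans y≡c (sym z≡c))

¬trivial⇒inhabited : ExcludedMiddle 0ℓ → {X : Set} {A : Subset X} → ¬ IsTrivial A → ∃ A
¬trivial⇒inhabited em {A = A} nontrivial with em {∃ A}
... | yes inhabited = inhabited
... | no empty = ⊥-elim (nontrivial (inj₁ λ x ax → empty (x , ax)))

AllBut : {X : Set} → X → Subset X
AllBut a x = x ≢ a

allBut-nontrivial : ExcludedMiddle 0ℓ → {X : Set} → AtLeast3 X → (a : X) → ¬ IsTrivial (AllBut a)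
allBut-nontrivial em at3@(x , y , _ , x≢y , _) a = λ
  { (inj₁ empty)                  → empty x λ x≡a → empty y λ y≡a → x≢y (trans x≡a (sym y≡a))
  ; (inj₂ (inj₁ (_ , singleton))) → coveredByTwo⇒¬atLeast3 (aOrC singleton) at3
  ; (inj₂ (inj₂ all))             → all a refl
  }
  where
  aOrC : ∀ {c} → (∀ z → AllBut a z ⇔ (z ≡ c)) → ∀ z → z ≡ a ⊎ z ≡ c
  aOrC singleton z with em {z ≡ a}
  ... | yes z≡a = inj₁ z≡a
  ... | no z≢a  = inj₂ (to (singleton z) z≢a)

IsExtremum : {X : Set} → (X → X → Set) → X → Set
IsExtremum R a = (∀ x → x ≢ a → R x a) ⊎ (∀ x → x ≢ a → R a x)

extremum⇒allBut-isModule : ExcludedMiddle 0ℓ → {X : Set} {R : X → X → Set} → IsPartialOrder _≡_ R →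
  {a : X} → IsExtremum R a → IsModule R (AllBut a)
extremum⇒allBut-isModule em {R = R} po {a} extremum y y' x y≢a y'≢a ¬x≢a
  with em⇒dne em ¬x≢a
... | refl = compare extremum
  where
  open IsPartialOrder po using (antisym)
  compare : IsExtremum R a → (R a y ⇔ R a y') × (R y a ⇔ R y' a)
  compare (inj₁ maximum) =
    mk⇔ (λ a≤y → ⊥-elim (y≢a (antisym (maximum y y≢a) a≤y)))
        (λ a≤y' → ⊥-elim (y'≢a (antisym (maximum y' y'≢a) a≤y'))) ,
    mk⇔ (λ _ → maximum y' y'≢a) (λ _ → maximum y y≢a)
  compare (inj₂ minimum) =
    mk⇔ (λ _ → minimum y' y'≢a) (λ _ → minimum y y≢a) ,
    mk⇔ (λ y≤a → ⊥-elim (y≢a (antisym y≤a (minimum y y≢a))))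
        (λ y'≤a → ⊥-elim (y'≢a (antisym y'≤a (minimum y' y'≢a))))

prime⇒¬extremum : ExcludedMiddle 0ℓ → {X : Set} {R : X → X → Set} → IsPartialOrder _≡_ R →
  IsPrime R → AtLeast3 X → (a : X) → ¬ IsExtremum R a
prime⇒¬extremum em po prime at3 a extremum =
  allBut-nontrivial em at3 a (prime (AllBut a) (extremum⇒allBut-isModule em po extremum))

module LinearSum {I : Set} {_<_ : I → I → Set} (sto : IsStrictTotalOrder _≡_ _<_)
    {V : I → Set} (_≤[_]_ : ∀ {i} → V i → I → V i → Set) where

  open IsStrictTotalOrder sto using (irrefl; compare; _≟_) renaming (trans to <-trans)

  _≤Σ_ : Σ I V → Σ I V → Set
  _≤Σ_ = LinSum≤ _<_ V _≤[_]_

  Summand≤ : (i : I) → V i → V i → Set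
  Summand≤ i x y = x ≤[ i ] y

  inside⁻¹ : ∀ {i} {x y : V i} → (i , x) ≤Σ (i , y) → x ≤[ i ] y
  inside⁻¹ (inside x≤y) = x≤y
  inside⁻¹ (across i<i) = ⊥-elim (irrefl refl i<i)

  ≤Σ⇒≯ : ∀ {p q} → p ≤Σ q → ¬ (proj₁ q < proj₁ p)
  ≤Σ⇒≯ (inside _)   i<i = irrefl refl i<i
  ≤Σ⇒≯ (across i<j) j<i = irrefl refl (<-trans i<j j<i)

  Fibre : Subset (Σ I V) → (i : I) → Subset (V i)
  Fibre M i x = M (i , x)

  Support : Subset (Σ I V) → Subset I
  Support M i = ∃ (Fibre M i)

  module _ {M : Subset (Σ I V)} (isModule : IsModule _≤Σ_ M) where

    fibre-isModule : ∀ i → IsModule (Summand≤ i) (Fibre M i)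
    fibre-isModule i a a' x ma ma' ¬mx with isModule (i , a) (i , a') (i , x) ma ma' ¬mx
    ... | below , above = restrict below , restrict above
      where
      restrict : ∀ {p q p' q'} → (i , p) ≤Σ (i , q) ⇔ (i , p') ≤Σ (i , q') →
        p ≤[ i ] q ⇔ p' ≤[ i ] q'
      restrict e = mk⇔ (λ p≤q → inside⁻¹ (to e (inside p≤q)))
                       (λ p'≤q' → inside⁻¹ (from e (inside p'≤q')))

    singletonFibre⇒extremum : ∀ {i a j b} → (∀ y → Fibre M i y ⇔ (y ≡ a)) → M (j , b) → j ≢ i →
      IsExtremum (Summand≤ i) a
    singletonFibre⇒extremum {i} {a} {j} {b} singleton mb j≢i = byPosition (compare i j)
      where
      likeOutside : ∀ x → x ≢ a →
        ((i , x) ≤Σ (i , a) ⇔ (i , x) ≤Σ (j , b)) × ((i , a) ≤Σ (i , x) ⇔ (j , b) ≤Σ (i , x))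
      likeOutside x x≢a = isModule (i , a) (j , b) (i , x) (from (singleton a) refl) mb
                                   (λ mx → x≢a (to (singleton x) mx))
      byPosition : Tri (i < j) (i ≡ j) (j < i) → IsExtremum (Summand≤ i) a
      byPosition (tri< i<j _ _) =
        inj₁ λ x x≢a → inside⁻¹ (from (proj₁ (likeOutside x x≢a)) (across i<j))
      byPosition (tri≈ _ i≡j _) = ⊥-elim (j≢i (sym i≡j))
      byPosition (tri> _ _ j<i) =
        inj₂ λ x x≢a → inside⁻¹ (from (proj₂ (likeOutside x x≢a)) (across j<i))

    support-isInterval : ExcludedMiddle 0ℓ → (∀ i → V i) → IsInterval _<_ (Support M)
    support-isInterval em point i j k i<j j<k (x , mx) (z , mz) with em {M (j , point j)}
    ... | yes my = point j , my
    ... | no ¬my = ⊥-elim (≤Σ⇒≯ (to likeOutside (across i<j)) j<k)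
      where
      likeOutside : (i , x) ≤Σ (j , point j) ⇔ (k , z) ≤Σ (j , point j)
      likeOutside = proj₂ (isModule (i , x) (k , z) (j , point j) mx mz ¬my)

  module _ (em : ExcludedMiddle 0ℓ)
      (po : ∀ i → IsPartialOrder _≡_ (Summand≤ i))
      (prime : ∀ i → IsPrime (Summand≤ i))
      (at3 : ∀ i → AtLeast3 (V i))
      {M : Subset (Σ I V)} (isModule : IsModule _≤Σ_ M) (nontrivial : ¬ IsTrivial M) where

    fibre-¬singleton : ∀ i a → ¬ (∀ y → Fibre M i y ⇔ (y ≡ a))
    fibre-¬singleton i a singleton = nontrivial (inj₂ (inj₁ ((i , a) , onlyPoint)))
      where
      onlyPoint : ∀ p → M p ⇔ (p ≡ (i , a))
      onlyPoint (j , b) with j ≟ i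
      ... | yes refl = mk⇔ (λ mb → cong (i ,_) (to (singleton b) mb))
                           (λ { refl → from (singleton a) refl })
      ... | no j≢i   = mk⇔ (λ mb → ⊥-elim (prime⇒¬extremum em (po i) (prime i) (at3 i) a
                                              (singletonFibre⇒extremum isModule singleton mb j≢i)))
                           (λ { refl → ⊥-elim (j≢i refl) })

    fibre-inhabited⇒full : ∀ {i x y} → M (i , y) → M (i , x)
    fibre-inhabited⇒full {i} {x} {y} my with prime i (Fibre M i) (fibre-isModule isModule i)
    ... | inj₁ empty                   = ⊥-elim (empty y my)
    ... | inj₂ (inj₁ (a , singleton)) = ⊥-elim (fibre-¬singleton i a singleton)
    ... | inj₂ (inj₂ all)             = all x

lemma2p2 : ExcludedMiddle 0ℓ →
    (I : Set) (_<_ : I → I → Set) → IsStrictTotalOrder _≡_ _<_ →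
    (∃ λ (i : I) → ∃ λ (j : I) → i ≢ j) →
    (V : I → Set) (_≤[_]_ : ∀ {i} → V i → I → V i → Set) →
    (∀ i → IsPartialOrder _≡_ (λ (x y : V i) → x ≤[ i ] y)) →
    (∀ i → IsPrime (λ (x y : V i) → x ≤[ i ] y)) →
    (∀ i → AtLeast4 (V i)) →
    (M : Subset (Σ I V)) → IsNontrivialModule (LinSum≤ _<_ V _≤[_]_) M →
    Σ (Subset I) λ J → IsNontrivialInterval _<_ J ×
      (∀ (i : I) (x : V i) → M (i , x) ⇔ J i)
lemma2p2 em I _<_ sto _ V _≤[_]_ po prime at4 M (isModule , nontrivial) =
  Support M ,
  (support-isInterval isModule em (λ i → proj₁ (at4 i)) , nonempty , notAll) ,
  λ i x → mk⇔ (x ,_) (λ (y , my) → full my)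
  where
  open LinearSum sto _≤[_]_

  full : ∀ {i x y} → M (i , y) → M (i , x)
  full = fibre-inhabited⇒full em po prime (λ i → atLeast4⇒atLeast3 (at4 i)) isModule nontrivial

  nonempty : ∃ (Support M)
  nonempty with ¬trivial⇒inhabited em nontrivial
  ... | (i , x) , mx = i , x , mx

  notAll : ¬ (∀ i → Support M i)
  notAll all = nontrivial (inj₂ (inj₂ λ (i , x) → full (proj₂ (all i))))
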